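{- Let $q\ge 1$ and let $f(x)\in\mathbb{Z}[x]$ have degree $2q$ and be self-reciprocal, i.e. $x^{2q}f(x^{ -1})=f(x)$. Then: (i) $2f'''(1)$ is divisible by $2q-2$; moreover, if $q$ is even, then $f'''(1)$ is divisible by $2q-2$. (ii) For every integer $k\ge 2$, $f^{(2k+1)}(1)$ is divisible by $2q-2k$.
   Context: Divisibility is in $\mathbb{Z}$; an integer is divisible by $0$ only if it equals $0$. -}

module Defs where

open import Data.Nat using (ℕ; zero; suc)
open import Data.Integer using (ℤ; +_; _*_; _+_; 0ℤ)
open import Data.List using (List; []; _∷_)

-- A polynomial in ℤ[x] given by its coefficient list, lowest degree first:
-- a₀ ∷ a₁ ∷ … represents a₀ + a₁ x + a₂ x² + …
Poly : Set
Poly = List ℤ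

eval1 : Poly → ℤ
eval1 []       = 0ℤ
eval1 (a ∷ as) = a + eval1 as

derivAux : ℕ → Poly → Poly
derivAux k []       = []
derivAux k (a ∷ as) = (+ k * a) ∷ derivAux (suc k) as

deriv : Poly → Poly
deriv []       = []
deriv (a ∷ as) = derivAux 1 as

derivN : ℕ → Poly → Poly
derivN zero    p = p
derivN (suc m) p = deriv (derivN m p)

derivAt1 : ℕ → Poly → ℤ
derivAt1 m p = eval1 (derivN m p)

{-# OPTIONS --safe #-}
-- Writing f = Σ aᵢ xⁱ, one has f⁽ᵐ⁾(1) = Σ aᵢ i^↓m with the falling factorial i^↓m = i(i-1)⋯(i-m+1).
-- For odd m = 2k+1 the reflection (2k - x)^↓m = -x^↓m, together with 2q - i ≡ 2k - i modulo
-- 2q - 2k, makes every pair term i^↓m + (2q-i)^↓m divisible by 2q - 2k. Since aᵢ = a₂q₋ᵢ,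
-- summing over all i expresses 2f⁽ᵐ⁾(1) through pair terms, and summing only over i > q expresses
-- f⁽ᵐ⁾(1) through pair terms and the centre term a_q q^↓m. That centre term is divisible by
-- 2(q - k): for k ≥ 2 the product q^↓m contains (q-k+2)(q-k+1)(q-k), and for k = 1 and q even
-- q(q-1)(q-2) = 2 (q/2) (q-1)(q-2).
module Submission where

open import Defs
open import Data.Nat using (ℕ; suc; _≤_)
open import Data.Nat as ℕ using ()
open import Data.Nat.Divisibility using () renaming (_∣_ to _∣ℕ_)
open import Data.Integer using (ℤ; +_; _-_; _*_; 0ℤ)
open import Data.Integer.Divisibility using (_∣_)
open import Data.Vec using (Vec; lookup; reverse; toList)
open import Data.Fin using (fromℕ)
open import Data.Product using (_×_)
open import Relation.Binary.PropositionalEquality using (_≡_; _≢_)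

open import Data.Nat using (zero; _<_; _∸_; s≤s; z<s; s<s)
import Data.Nat.Properties as ℕₚ
import Data.Nat.Tactic.RingSolver as ℕ-Ring
open import Data.Integer using (_+_; -_; 1ℤ; -1ℤ; -[1+_]; _^_)
import Data.Integer.Properties as ℤₚ
open import Data.Integer.Divisibility.Signed
  using (divides; ∣-refl; ∣-trans; ∣ᵤ⇒∣; ∣⇒∣ᵤ; ∣m∣n⇒∣m+n; ∣m⇒∣m*n; ∣n⇒∣m*n)
  renaming (_∣_ to _∣ˢ_)
open import Data.Integer.Tactic.RingSolver using (solve-∀)
open import Data.List as List using (List; []; _∷_; _∷ʳ_; length)
open import Data.List.Properties using (unfold-reverse; length-reverse)
open import Data.Vec.Properties using (toList-reverse; length-toList)
open import Data.Product using (_,_)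
open import Relation.Binary.Definitions using (tri<; tri≈; tri>)
open import Relation.Binary.PropositionalEquality
  using (refl; sym; trans; cong; cong₂; subst; module ≡-Reasoning)
open ≡-Reasoning

weightedSum : (ℕ → ℤ) → List ℤ → ℤ
weightedSum w []       = 0ℤ
weightedSum w (a ∷ as) = a * w 0 + weightedSum (λ i → w (suc i)) as

weightedSum-cong : ∀ {w v} (as : List ℤ) → (∀ i → i < length as → w i ≡ v i) →
                   weightedSum w as ≡ weightedSum v as
weightedSum-cong []       _   = refl
weightedSum-cong (a ∷ as) w≡v =
  cong₂ (λ x s → a * x + s) (w≡v 0 z<s) (weightedSum-cong as (λ i i<n → w≡v (suc i) (s<s i<n)))

weightedSum-+ : ∀ w v as → weightedSum (λ i → w i + v i) as ≡ weightedSum w as + weightedSum v as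
weightedSum-+ w v []       = refl
weightedSum-+ w v (a ∷ as) =
  trans (cong (_+_ (a * (w 0 + v 0))) (weightedSum-+ _ _ as)) (distrib a (w 0) (v 0) _ _)
  where
  distrib : ∀ a x y s t → a * (x + y) + (s + t) ≡ (a * x + s) + (a * y + t)
  distrib = solve-∀

weightedSum-neg : ∀ w as → weightedSum (λ i → - w i) as ≡ - weightedSum w as
weightedSum-neg w []       = refl
weightedSum-neg w (a ∷ as) =
  trans (cong (_+_ (a * - w 0)) (weightedSum-neg _ as)) (distrib a (w 0) _)
  where
  distrib : ∀ a x s → a * - x + - s ≡ - (a * x + s)
  distrib = solve-∀

weightedSum-∣ : ∀ {d} w as → (∀ i → i < length as → d ∣ˢ w i) → d ∣ˢ weightedSum w as
weightedSum-∣ w []       _   = divides 0ℤ refl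
weightedSum-∣ w (a ∷ as) d∣w =
  ∣m∣n⇒∣m+n (∣n⇒∣m*n a (d∣w 0 z<s)) (weightedSum-∣ _ as (λ i i<n → d∣w (suc i) (s<s i<n)))

weightedSum-∷ʳ : ∀ w as a → weightedSum w (as ∷ʳ a) ≡ weightedSum w as + a * w (length as)
weightedSum-∷ʳ w []       a = ℤₚ.+-comm (a * w 0) 0ℤ
weightedSum-∷ʳ w (x ∷ as) a =
  trans (cong (_+_ (x * w 0)) (weightedSum-∷ʳ _ as a)) (sym (ℤₚ.+-assoc (x * w 0) _ _))

weightedSum-reverse : ∀ w as →
  weightedSum w (List.reverse as) ≡ weightedSum (λ i → w (length as ∸ suc i)) as
weightedSum-reverse w []       = refl
weightedSum-reverse w (a ∷ as) = begin
  weightedSum w (List.reverse (a ∷ as))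
    ≡⟨ cong (weightedSum w) (unfold-reverse a as) ⟩
  weightedSum w (List.reverse as ∷ʳ a)
    ≡⟨ weightedSum-∷ʳ w (List.reverse as) a ⟩
  weightedSum w (List.reverse as) + a * w (length (List.reverse as))
    ≡⟨ cong₂ (λ s n → s + a * w n) (weightedSum-reverse w as) (length-reverse as) ⟩
  weightedSum (λ i → w (length as ∸ suc i)) as + a * w (length as)
    ≡⟨ ℤₚ.+-comm _ (a * w (length as)) ⟩
  a * w (length as) + weightedSum (λ i → w (length as ∸ suc i)) as
    ∎

toList-index-≤ : ∀ {A : Set} {n i} (f : Vec A (suc n)) → i < length (toList f) → i ≤ n
toList-index-≤ {i = i} f i<len = ℕₚ.≤-pred (subst (i <_) (length-toList f) i<len)

module _ {n} (f : Vec ℤ (suc n)) (f-palindrome : reverse f ≡ f) where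

  private
    coeffs : List ℤ
    coeffs = toList f

  palindrome-weightedSum-reflect : ∀ w → weightedSum w coeffs ≡ weightedSum (λ i → w (n ∸ i)) coeffs
  palindrome-weightedSum-reflect w = begin
    weightedSum w coeffs                  ≡⟨ cong (λ g → weightedSum w (toList g)) (sym f-palindrome) ⟩
    weightedSum w (toList (reverse f))    ≡⟨ cong (weightedSum w) (toList-reverse f) ⟩
    weightedSum w (List.reverse coeffs)   ≡⟨ weightedSum-reverse w coeffs ⟩
    weightedSum (λ i → w (length coeffs ∸ suc i)) coeffs
      ≡⟨ cong (λ m → weightedSum (λ i → w (m ∸ suc i)) coeffs) (length-toList f) ⟩
    weightedSum (λ i → w (n ∸ i)) coeffs  ∎

  palindrome-∣-2*weightedSum : ∀ {d} w → (∀ i → i ≤ n → d ∣ˢ w i + w (n ∸ i)) →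
                               d ∣ˢ + 2 * weightedSum w coeffs
  palindrome-∣-2*weightedSum {d} w d∣pair = subst (d ∣ˢ_) symmetrise
    (weightedSum-∣ _ coeffs (λ i i<len → d∣pair i (toList-index-≤ f i<len)))
    where
    double : ∀ s → s + s ≡ + 2 * s
    double = solve-∀
    symmetrise : weightedSum (λ i → w i + w (n ∸ i)) coeffs ≡ + 2 * weightedSum w coeffs
    symmetrise = begin
      weightedSum (λ i → w i + w (n ∸ i)) coeffs
        ≡⟨ weightedSum-+ w _ coeffs ⟩
      weightedSum w coeffs + weightedSum (λ i → w (n ∸ i)) coeffs
        ≡⟨ cong (_+_ (weightedSum w coeffs)) (sym (palindrome-weightedSum-reflect w)) ⟩
      weightedSum w coeffs + weightedSum w coeffs
        ≡⟨ double _ ⟩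
      + 2 * weightedSum w coeffs ∎

truncate : ℕ → (ℕ → ℤ) → ℕ → ℤ
truncate zero    w i       = 0ℤ
truncate (suc q) w zero    = w 0
truncate (suc q) w (suc i) = truncate q (λ j → w (suc j)) i

truncate-< : ∀ {q i} w → i < q → truncate q w i ≡ w i
truncate-< {suc q} {zero}  w _         = refl
truncate-< {suc q} {suc i} w (s<s i<q) = truncate-< (λ j → w (suc j)) i<q

truncate-≥ : ∀ {q i} w → q ≤ i → truncate q w i ≡ 0ℤ
truncate-≥ {zero}          w _         = refl
truncate-≥ {suc q} {suc i} w (s≤s q≤i) = truncate-≥ (λ j → w (suc j)) q≤i

2*q∸q≡q : ∀ q → 2 ℕ.* q ∸ q ≡ q
2*q∸q≡q q = trans (ℕₚ.m+n∸m≡n q (q ℕ.+ 0)) (ℕₚ.+-identityʳ q)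

module _ {q} (f : Vec ℤ (suc (2 ℕ.* q))) (f-palindrome : reverse f ≡ f) where

  private
    coeffs : List ℤ
    coeffs = toList f

    n : ℕ
    n = 2 ℕ.* q

  -- The weights on the indices i < q may be moved to the mirror indices 2q - i without changing
  -- the sum; the resulting folded weights are 0 below q, w q at q and pair sums above q.
  palindrome-∣-weightedSum : ∀ {d} w → (∀ i → i ≤ n → d ∣ˢ w i + w (n ∸ i)) → d ∣ˢ w q →
                             d ∣ˢ weightedSum w coeffs
  palindrome-∣-weightedSum {d} w d∣pair d∣centre = subst (d ∣ˢ_) fold-sum
    (weightedSum-∣ folded coeffs (λ i i<len → d∣folded i (toList-index-≤ f i<len)))
    where
    low : ℕ → ℤ
    low = truncate q w
    folded : ℕ → ℤ
    folded i = w i - low i + low (n ∸ i)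

    cancel : ∀ s t → s - t + t ≡ s
    cancel = solve-∀
    fold-sum : weightedSum folded coeffs ≡ weightedSum w coeffs
    fold-sum = begin
      weightedSum folded coeffs
        ≡⟨ weightedSum-+ _ _ coeffs ⟩
      weightedSum (λ i → w i - low i) coeffs + weightedSum (λ i → low (n ∸ i)) coeffs
        ≡⟨ cong₂ _+_ (trans (weightedSum-+ w _ coeffs)
                            (cong (_+_ (weightedSum w coeffs)) (weightedSum-neg low coeffs)))
                     (sym (palindrome-weightedSum-reflect f f-palindrome low)) ⟩
      weightedSum w coeffs - weightedSum low coeffs + weightedSum low coeffs
        ≡⟨ cancel _ _ ⟩
      weightedSum w coeffs ∎

    q≤n : q ≤ n
    q≤n = ℕₚ.m≤m+n q (q ℕ.+ 0)

    d∣folded : ∀ i → i ≤ n → d ∣ˢ folded i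
    d∣folded i i≤n with ℕₚ.<-cmp i q
    ... | tri< i<q _ _ = subst (d ∣ˢ_) (sym value) (divides 0ℤ refl)
      where
      q≤mirror : q ≤ n ∸ i
      q≤mirror = ℕₚ.<⇒≤ (subst (_< n ∸ i) (2*q∸q≡q q) (ℕₚ.∸-monoʳ-< i<q q≤n))
      vanish : ∀ s → s - s + 0ℤ ≡ 0ℤ
      vanish = solve-∀
      value : folded i ≡ 0ℤ
      value rewrite truncate-< w i<q | truncate-≥ w q≤mirror = vanish (w i)
    ... | tri≈ _ refl _ = subst (d ∣ˢ_) (sym value) d∣centre
      where
      identity : ∀ s → s - 0ℤ + 0ℤ ≡ s
      identity = solve-∀
      value : folded q ≡ w q
      value rewrite 2*q∸q≡q q | truncate-≥ w (ℕₚ.≤-refl {q}) = identity (w q)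
    ... | tri> _ _ q<i = subst (d ∣ˢ_) (sym value) (d∣pair i i≤n)
      where
      mirror<q : n ∸ i < q
      mirror<q = subst (n ∸ i <_) (2*q∸q≡q q) (ℕₚ.∸-monoʳ-< q<i i≤n)
      identity : ∀ s t → s - 0ℤ + t ≡ s + t
      identity = solve-∀
      value : folded i ≡ w i + w (n ∸ i)
      value rewrite truncate-≥ w (ℕₚ.<⇒≤ q<i) | truncate-< w mirror<q = identity (w i) (w (n ∸ i))

infixr 8 _^↓_

_^↓_ : ℤ → ℕ → ℤ
x ^↓ zero  = 1ℤ
x ^↓ suc m = x * (x - 1ℤ) ^↓ m

^↓-suc : ∀ m x → x ^↓ suc m ≡ x ^↓ m * (x - + m)
^↓-suc zero    x = shape x
  where
  shape : ∀ x → x * 1ℤ ≡ 1ℤ * (x - + 0)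
  shape = solve-∀
^↓-suc (suc m) x = trans (cong (x *_) (^↓-suc m (x - 1ℤ))) (shape x ((x - 1ℤ) ^↓ m) (+ m))
  where
  shape : ∀ x p m → x * (p * (x - 1ℤ - m)) ≡ x * p * (x - (1ℤ + m))
  shape = solve-∀

^↓-+ : ∀ a b x → x ^↓ (a ℕ.+ b) ≡ x ^↓ a * (x - + a) ^↓ b
^↓-+ zero    b x = trans (cong (_^↓ b) (sym (ℤₚ.+-identityʳ x))) (sym (ℤₚ.*-identityˡ _))
^↓-+ (suc a) b x = begin
  x * (x - 1ℤ) ^↓ (a ℕ.+ b)                      ≡⟨ cong (x *_) (^↓-+ a b (x - 1ℤ)) ⟩
  x * ((x - 1ℤ) ^↓ a * (x - 1ℤ - + a) ^↓ b)      ≡⟨ cong (λ y → x * ((x - 1ℤ) ^↓ a * y ^↓ b)) (shift x (+ a)) ⟩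
  x * ((x - 1ℤ) ^↓ a * (x - (1ℤ + + a)) ^↓ b)    ≡⟨ sym (ℤₚ.*-assoc x _ _) ⟩
  x * (x - 1ℤ) ^↓ a * (x - + suc a) ^↓ b         ∎
  where
  shift : ∀ x a → x - 1ℤ - a ≡ x - (1ℤ + a)
  shift = solve-∀

^↓-block-∣ : ∀ a b c x → (x - + b) ^↓ a ∣ˢ x ^↓ (b ℕ.+ (a ℕ.+ c))
^↓-block-∣ a b c x = subst (_ ∣ˢ_) (sym factorise) (∣n⇒∣m*n (x ^↓ b) (∣m⇒∣m*n _ ∣-refl))
  where
  factorise : x ^↓ (b ℕ.+ (a ℕ.+ c)) ≡ x ^↓ b * ((x - + b) ^↓ a * (x - + b - + a) ^↓ c)
  factorise = trans (^↓-+ b (a ℕ.+ c) x) (cong (x ^↓ b *_) (^↓-+ a c (x - + b)))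

^↓-reflect : ∀ j x → (+ j - x) ^↓ suc j ≡ -1ℤ ^ suc j * x ^↓ suc j
^↓-reflect zero    x = shape x
  where
  shape : ∀ x → (+ 0 - x) * 1ℤ ≡ -1ℤ * 1ℤ * (x * 1ℤ)
  shape = solve-∀
^↓-reflect (suc j) x = begin
  (+ suc j - x) * (+ suc j - x - 1ℤ) ^↓ suc j        ≡⟨ cong (λ y → (+ suc j - x) * y ^↓ suc j) (step (+ j) x) ⟩
  (+ suc j - x) * (+ j - x) ^↓ suc j                 ≡⟨ cong ((+ suc j - x) *_) (^↓-reflect j x) ⟩
  (+ suc j - x) * (-1ℤ ^ suc j * x ^↓ suc j)         ≡⟨ regroup (+ suc j) x (-1ℤ ^ suc j) (x ^↓ suc j) ⟩
  -1ℤ * -1ℤ ^ suc j * (x ^↓ suc j * (x - + suc j))   ≡⟨ cong (-1ℤ * -1ℤ ^ suc j *_) (sym (^↓-suc (suc j) x)) ⟩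
  -1ℤ ^ suc (suc j) * x ^↓ suc (suc j)               ∎
  where
  step : ∀ j x → 1ℤ + j - x - 1ℤ ≡ j - x
  step = solve-∀
  regroup : ∀ y x s p → (y - x) * (s * p) ≡ -1ℤ * s * (p * (x - y))
  regroup = solve-∀

-1^odd : ∀ k → -1ℤ ^ suc (2 ℕ.* k) ≡ -1ℤ
-1^odd k = cong (-1ℤ *_) (trans (sym (ℤₚ.^-*-assoc -1ℤ 2 k)) (ℤₚ.^-zeroˡ k))

^↓-cong-∣ : ∀ m {d} x y → d ∣ˢ x - y → d ∣ˢ x ^↓ m - y ^↓ m
^↓-cong-∣ zero    x y _     = divides 0ℤ refl
^↓-cong-∣ (suc m) {d} x y d∣x-y = subst (d ∣ˢ_) (sym (expand x y _ _))
  (∣m∣n⇒∣m+n (∣n⇒∣m*n x (^↓-cong-∣ m (x - 1ℤ) (y - 1ℤ) (subst (d ∣ˢ_) (shift x y) d∣x-y)))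
             (∣m⇒∣m*n ((y - 1ℤ) ^↓ m) d∣x-y))
  where
  expand : ∀ x y s t → x * s - y * t ≡ x * (s - t) + (x - y) * t
  expand = solve-∀
  shift : ∀ x y → x - y ≡ x - 1ℤ - (y - 1ℤ)
  shift = solve-∀

^↓-odd-reflect-∣ : ∀ n k x → (+ n - + (2 ℕ.* k)) ∣ˢ x ^↓ suc (2 ℕ.* k) + (+ n - x) ^↓ suc (2 ℕ.* k)
^↓-odd-reflect-∣ n k x = subst (_ ∣ˢ_) pair-sum
  (^↓-cong-∣ m (+ n - x) (+ j - x) (subst (_ ∣ˢ_) (difference (+ n) (+ j) x) ∣-refl))
  where
  j m : ℕ
  j = 2 ℕ.* k
  m = suc j
  difference : ∀ n j x → n - j ≡ n - x - (j - x)
  difference = solve-∀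
  flip : ∀ s t → t - -1ℤ * s ≡ s + t
  flip = solve-∀
  pair-sum : (+ n - x) ^↓ m - (+ j - x) ^↓ m ≡ x ^↓ m + (+ n - x) ^↓ m
  pair-sum = begin
    (+ n - x) ^↓ m - (+ j - x) ^↓ m           ≡⟨ cong (λ y → (+ n - x) ^↓ m - y) (^↓-reflect j x) ⟩
    (+ n - x) ^↓ m - -1ℤ ^ m * x ^↓ m         ≡⟨ cong (λ s → (+ n - x) ^↓ m - s * x ^↓ m) (-1^odd k) ⟩
    (+ n - x) ^↓ m - -1ℤ * x ^↓ m             ≡⟨ flip (x ^↓ m) _ ⟩
    x ^↓ m + (+ n - x) ^↓ m                   ∎

2∣^↓2 : ∀ x → + 2 ∣ˢ x ^↓ 2
2∣^↓2 (+ n)    = 2∣[+n]^↓2 n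
  where
  2∣[+n]^↓2 : ∀ n → + 2 ∣ˢ (+ n) ^↓ 2
  2∣[+n]^↓2 zero    = divides 0ℤ refl
  2∣[+n]^↓2 (suc n) =
    subst (+ 2 ∣ˢ_) (sym (step (+ n))) (∣m∣n⇒∣m+n (2∣[+n]^↓2 n) (divides (+ n) refl))
    where
    step : ∀ x → (1ℤ + x) * ((1ℤ + x - 1ℤ) * 1ℤ) ≡ x * ((x - 1ℤ) * 1ℤ) + x * + 2
    step = solve-∀
2∣^↓2 -[1+ n ] = subst (+ 2 ∣ˢ_) (sym (negate (+ suc n))) (2∣^↓2 (+ (suc n ℕ.+ 1)))
  where
  negate : ∀ y → - y * ((- y - 1ℤ) * 1ℤ) ≡ (y + 1ℤ) * ((y + 1ℤ - 1ℤ) * 1ℤ)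
  negate = solve-∀

2*[x-2]∣^↓3 : ∀ x → + 2 * (x - + 2) ∣ˢ x ^↓ 3
2*[x-2]∣^↓3 x with 2∣^↓2 x
... | divides u x^↓2≡u*2 = divides u (begin
  x ^↓ 3                  ≡⟨ ^↓-suc 2 x ⟩
  x ^↓ 2 * (x - + 2)      ≡⟨ cong (_* (x - + 2)) x^↓2≡u*2 ⟩
  u * + 2 * (x - + 2)     ≡⟨ ℤₚ.*-assoc u (+ 2) _ ⟩
  u * (+ 2 * (x - + 2))   ∎)

2*[x-1]∣^↓3 : ∀ {x} → + 2 ∣ˢ x → + 2 * (x - 1ℤ) ∣ˢ x ^↓ 3
2*[x-1]∣^↓3 {x} (divides u x≡u*2) =
  divides (u * (x - + 2)) (trans (cong (_* (x - 1ℤ) ^↓ 2) x≡u*2) (regroup u x))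
  where
  regroup : ∀ u x → u * + 2 * ((x - 1ℤ) * ((x - 1ℤ - 1ℤ) * 1ℤ)) ≡ u * (x - + 2) * (+ 2 * (x - 1ℤ))
  regroup = solve-∀

-- The block (x-(k-2))^↓3 = (x-k+2)(x-k+1)(x-k) of x^↓(2k+1) is already divisible by 2(x-k).
^↓-odd-centre-∣ : ∀ k x → 2 ≤ k → + 2 * (x - + k) ∣ˢ x ^↓ suc (2 ℕ.* k)
^↓-odd-centre-∣ (suc (suc t)) x (s≤s (s≤s _)) = ∣-trans
  (subst (_∣ˢ (x - + t) ^↓ 3) (shift x (+ t)) (2*[x-2]∣^↓3 (x - + t)))
  (subst (λ m → (x - + t) ^↓ 3 ∣ˢ x ^↓ m) (sym (split t)) (^↓-block-∣ 3 t (t ℕ.+ 2) x))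
  where
  shift : ∀ x t → + 2 * (x - t - + 2) ≡ + 2 * (x - (+ 2 + t))
  shift = solve-∀
  split : ∀ t → suc (2 ℕ.* (2 ℕ.+ t)) ≡ t ℕ.+ (3 ℕ.+ (t ℕ.+ 2))
  split = ℕ-Ring.solve-∀

weightedSum-derivAux : ∀ k w as →
  weightedSum w (derivAux k as) ≡ weightedSum (λ i → + (k ℕ.+ i) * w i) as
weightedSum-derivAux k w []       = refl
weightedSum-derivAux k w (a ∷ as) = cong₂ _+_
  (trans (regroup (+ k) a (w 0)) (cong (λ j → a * (+ j * w 0)) (sym (ℕₚ.+-identityʳ k))))
  (trans (weightedSum-derivAux (suc k) _ as)
         (weightedSum-cong as (λ i _ → cong (λ j → + j * w (suc i)) (sym (ℕₚ.+-suc k i)))))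
  where
  regroup : ∀ k a x → k * a * x ≡ a * (k * x)
  regroup = solve-∀

weightedSum-deriv : ∀ w as → weightedSum w (deriv as) ≡ weightedSum (λ i → + i * w (i ∸ 1)) as
weightedSum-deriv w []       = refl
weightedSum-deriv w (a ∷ as) = trans (weightedSum-derivAux 1 w as) (sym (drop-zero a (w 0) _))
  where
  drop-zero : ∀ a x s → a * (+ 0 * x) + s ≡ s
  drop-zero = solve-∀

derivN-suc : ∀ m p → derivN (suc m) p ≡ derivN m (deriv p)
derivN-suc zero    p = refl
derivN-suc (suc m) p = cong deriv (derivN-suc m p)

eval1≡weightedSum : ∀ p → eval1 p ≡ weightedSum (λ _ → 1ℤ) p
eval1≡weightedSum []       = refl
eval1≡weightedSum (a ∷ as) = cong₂ _+_ (sym (ℤₚ.*-identityʳ a)) (eval1≡weightedSum as)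

derivAt1≡weightedSum-^↓ : ∀ m p → derivAt1 m p ≡ weightedSum (λ i → (+ i) ^↓ m) p
derivAt1≡weightedSum-^↓ zero    p = eval1≡weightedSum p
derivAt1≡weightedSum-^↓ (suc m) p = begin
  eval1 (derivN (suc m) p)                      ≡⟨ cong eval1 (derivN-suc m p) ⟩
  derivAt1 m (deriv p)                          ≡⟨ derivAt1≡weightedSum-^↓ m (deriv p) ⟩
  weightedSum (λ i → (+ i) ^↓ m) (deriv p)      ≡⟨ weightedSum-deriv _ p ⟩
  weightedSum (λ i → + i * (+ (i ∸ 1)) ^↓ m) p  ≡⟨ weightedSum-cong p (λ i _ → falling i) ⟩
  weightedSum (λ i → (+ i) ^↓ suc m) p          ∎
  where
  falling : ∀ i → + i * (+ (i ∸ 1)) ^↓ m ≡ (+ i) ^↓ suc m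
  falling zero    = refl
  falling (suc i) = refl

^↓-odd-mirror-∣ : ∀ n k i → i ≤ n →
  (+ n - + (2 ℕ.* k)) ∣ˢ (+ i) ^↓ suc (2 ℕ.* k) + (+ (n ∸ i)) ^↓ suc (2 ℕ.* k)
^↓-odd-mirror-∣ n k i i≤n =
  subst (λ y → _ ∣ˢ (+ i) ^↓ suc (2 ℕ.* k) + y ^↓ suc (2 ℕ.* k))
        (trans (ℤₚ.[+m]-[+n]≡m⊖n n i) (ℤₚ.≤-⊖ i≤n))
        (^↓-odd-reflect-∣ n k (+ i))

palindrome-∣-2*derivAt1-odd : ∀ {n} (f : Vec ℤ (suc n)) → reverse f ≡ f → ∀ k →
  (+ n - + (2 ℕ.* k)) ∣ˢ + 2 * derivAt1 (suc (2 ℕ.* k)) (toList f)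
palindrome-∣-2*derivAt1-odd {n} f f-palindrome k =
  subst (λ s → _ ∣ˢ + 2 * s) (sym (derivAt1≡weightedSum-^↓ (suc (2 ℕ.* k)) (toList f)))
        (palindrome-∣-2*weightedSum {n} f f-palindrome _ (^↓-odd-mirror-∣ n k))

palindrome-∣-derivAt1-odd : ∀ {q} (f : Vec ℤ (suc (2 ℕ.* q))) → reverse f ≡ f → ∀ k →
  (+ (2 ℕ.* q) - + (2 ℕ.* k)) ∣ˢ (+ q) ^↓ suc (2 ℕ.* k) →
  (+ (2 ℕ.* q) - + (2 ℕ.* k)) ∣ˢ derivAt1 (suc (2 ℕ.* k)) (toList f)
palindrome-∣-derivAt1-odd {q} f f-palindrome k d∣centre =
  subst (_ ∣ˢ_) (sym (derivAt1≡weightedSum-^↓ (suc (2 ℕ.* k)) (toList f)))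
        (palindrome-∣-weightedSum {q} f f-palindrome _ (^↓-odd-mirror-∣ (2 ℕ.* q) k) d∣centre)

+[2*q]-+[2*k]≡2*[q-k] : ∀ q k → + (2 ℕ.* q) - + (2 ℕ.* k) ≡ + 2 * (+ q - + k)
+[2*q]-+[2*k]≡2*[q-k] q k =
  trans (cong₂ _-_ (ℤₚ.pos-* 2 q) (ℤₚ.pos-* 2 k)) (factor (+ q) (+ k))
  where
  factor : ∀ q k → + 2 * q - + 2 * k ≡ + 2 * (q - k)
  factor = solve-∀

proposition2p6 : (q : ℕ) → 1 ≤ q →
    (f : Vec ℤ (suc (2 ℕ.* q))) →
    lookup f (fromℕ (2 ℕ.* q)) ≢ 0ℤ →
    reverse f ≡ f →
    ((+ (2 ℕ.* q) - + 2) ∣ (+ 2 * derivAt1 3 (toList f)))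
    × ((2 ∣ℕ q) → (+ (2 ℕ.* q) - + 2) ∣ derivAt1 3 (toList f))
    × ((k : ℕ) → 2 ≤ k →
         (+ (2 ℕ.* q) - + (2 ℕ.* k)) ∣ derivAt1 (suc (2 ℕ.* k)) (toList f))
proposition2p6 q _ f _ f-palindrome =
    ∣⇒∣ᵤ (palindrome-∣-2*derivAt1-odd {2 ℕ.* q} f f-palindrome 1)
  , (λ 2∣q → ∣⇒∣ᵤ (palindrome-∣-derivAt1-odd {q} f f-palindrome 1
       (subst (_∣ˢ (+ q) ^↓ 3) (sym (+[2*q]-+[2*k]≡2*[q-k] q 1)) (2*[x-1]∣^↓3 {+ q} (∣ᵤ⇒∣ 2∣q)))))
  , (λ k 2≤k → ∣⇒∣ᵤ (palindrome-∣-derivAt1-odd {q} f f-palindrome k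
       (subst (_∣ˢ (+ q) ^↓ suc (2 ℕ.* k)) (sym (+[2*q]-+[2*k]≡2*[q-k] q k))
              (^↓-odd-centre-∣ k (+ q) 2≤k))))
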